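{- There is no squco graph of girth $6$. That is, there is no finite simple graph $G$ whose shortest cycle has length exactly $6$ and such that the square $G^2$ is isomorphic to the complement $\overline{G}$.
   Context: All graphs are finite and simple. The square $G^2$ of a graph $G$ has vertex set $V(G)$, and two distinct vertices are adjacent in $G^2$ if and only if their distance in $G$ is at most $2$. A graph $G$ is square-complementary (squco) if $G^2 \cong \overline{G}$, where $\overline{G}$ is the complement of $G$. The girth of $G$ is the length of a shortest cycle in $G$ ($\infty$ if $G$ is acyclic). -}

module Defs where

open import Data.Nat using (ℕ; zero; suc; _≤_)
open import Data.Fin using (Fin; zero; suc; inject₁; fromℕ)
open import Data.Bool using (Bool; true; false)
open import Data.Product using (Σ; ∃; _×_; _,_)
open import Data.Sum using (_⊎_)
open import Data.Empty using (⊥)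
open import Relation.Binary.PropositionalEquality using (_≡_)
open import Relation.Nullary using (¬_)
open import Function.Definitions using (Injective)
open import Function.Bundles using (_↔_; _⇔_; Inverse)

record Graph (n : ℕ) : Set where
  field
    adj    : Fin n → Fin n → Bool
    sym    : ∀ u v → adj u v ≡ adj v u
    irrefl : ∀ v → adj v v ≡ false

open Graph public

Adj : ∀ {n} → Graph n → Fin n → Fin n → Set
Adj G u v = adj G u v ≡ true

HasCycleOfLength : ∀ {n} → Graph n → ℕ → Set
HasCycleOfLength G zero = ⊥
HasCycleOfLength {n} G (suc m) =
  3 ≤ suc m ×
  Σ (Fin (suc m) → Fin n) λ v →
    Injective _≡_ _≡_ v ×
    (∀ (i : Fin m) → Adj G (v (inject₁ i)) (v (suc i))) ×
    Adj G (v (fromℕ m)) (v zero)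

HasGirth : ∀ {n} → Graph n → ℕ → Set
HasGirth G k = HasCycleOfLength G k × (∀ l → HasCycleOfLength G l → k ≤ l)

SqAdj : ∀ {n} → Graph n → Fin n → Fin n → Set
SqAdj G u v = ¬ (u ≡ v) × (Adj G u v ⊎ ∃ λ w → Adj G u w × Adj G w v)

CoAdj : ∀ {n} → Graph n → Fin n → Fin n → Set
CoAdj G u v = ¬ (u ≡ v) × ¬ Adj G u v

Squco : ∀ {n} → Graph n → Set
Squco {n} G = Σ (Fin n ↔ Fin n) λ f →
  ∀ u v → SqAdj G u v ⇔ CoAdj G (Inverse.to f u) (Inverse.to f v)

-- Write σ for the isomorphism G² ≅ Ḡ: it maps the pairs at distance at least 3 exactly
-- onto the edges of G.  With girth 6 this rules out three pairwise far vertices (a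
-- triangle in G) and an edge uv where u and v both have two further neighbours (those
-- four vertices are far across the edge and σ maps them onto a 4-cycle); hence two far
-- vertices cannot both have three far vertices.  Now take a 6-cycle c0 … c5, whose
-- opposite vertices are far.  If it spans G, c3 is the only vertex far from c0, so σ c0
-- has at most one neighbour, while every vertex of the hexagon has two.  Otherwise a
-- vertex off the cycle is near c0 or c3 (the three cannot be pairwise far), so after a
-- rotation c0 has a third neighbour x.  If x is not near
-- c3, then x is far from c2, c3, c4 and G is the hexagon with the leaf x attached at c0;
-- c0 and c1 then each have a single far vertex, so σ c0 = x = σ c1.  If x ~ y ~ c3, G is
-- the theta graph formed by three paths c0 – c3 of length 3, in which again c3 is the
-- only vertex far from c0 while every vertex has two neighbours.

module Submission where

open import Defs
open import Data.Nat using (ℕ; _≤_; _<_; _+_; z<s; s<s)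
open import Data.Nat.Properties using (<⇒≱; +-monoʳ-<; m≤m+n)
open import Data.Fin using (Fin; zero; suc; inject₁; fromℕ; #_)
open import Data.Fin.Properties using (_≟_; any?)
open import Data.Bool using (true)
import Data.Bool.Properties as Bool
open import Data.Product using (Σ; ∃; _×_; _,_; proj₁; proj₂)
open import Data.Sum using (_⊎_; inj₁; inj₂; [_,_])
open import Data.Empty using (⊥; ⊥-elim)
open import Data.Vec using (Vec; []; _∷_; lookup)
open import Data.Vec.Relation.Unary.All using ([]; _∷_)
open import Data.Vec.Relation.Unary.Unique.Propositional using (Unique; []; _∷_)
open import Data.Vec.Relation.Unary.Unique.Propositional.Properties using (lookup-injective)
open import Data.List using (List; []; _∷_)
open import Data.List.Relation.Unary.All as All using (All; []; _∷_)
open import Data.List.Relation.Unary.All.Properties using (¬Any⇒All¬)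
open import Data.List.Relation.Unary.Any using (here; there; toSum)
open import Data.List.Membership.Propositional using (_∈_; _∉_)
import Data.List.Membership.DecPropositional as DecMembership
open import Data.List.Relation.Binary.Permutation.Propositional using (_↭_; prep; ↭-sym)
open import Data.List.Relation.Binary.Permutation.Propositional.Properties using (∈-resp-↭; shift)
open import Relation.Nullary using (¬_; yes; no; contradiction)
open import Relation.Nullary.Decidable using (Dec; decidable-stable; _⊎-dec_; _×-dec_)
open import Relation.Binary.PropositionalEquality
  using (_≡_; _≢_; refl; trans; cong; subst; ≢-sym) renaming (sym to ≡-sym)
open import Function.Base using (id)
open import Function.Bundles using (Inverse; Injection; Equivalence)
open import Function.Properties.Inverse using (↔⇒↣; ↔-sym)

module GraphProperties {n : ℕ} (G : Graph n) where

  private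
    V : Set
    V = Fin n

  open DecMembership (_≟_ {n}) using (_∈?_)

  Adj-sym : ∀ {u v} → Adj G u v → Adj G v u
  Adj-sym {u} {v} u~v = trans (sym G v u) u~v

  Adj⇒≢ : ∀ {u v} → Adj G u v → u ≢ v
  Adj⇒≢ {u} u~u refl with trans (≡-sym u~u) (irrefl G u)
  ... | ()

  Adj? : ∀ u v → Dec (Adj G u v)
  Adj? u v = adj G u v Bool.≟ true

  Near : V → V → Set
  Near u v = Adj G u v ⊎ ∃ λ w → Adj G u w × Adj G w v

  Far : V → V → Set
  Far u v = u ≢ v × ¬ Near u v

  Near? : ∀ u v → Dec (Near u v)
  Near? u v = Adj? u v ⊎-dec any? (λ w → Adj? u w ×-dec Adj? w v)

  Near-sym : ∀ {u v} → Near u v → Near v u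
  Near-sym (inj₁ u~v)             = inj₁ (Adj-sym u~v)
  Near-sym (inj₂ (w , u~w , w~v)) = inj₂ (w , Adj-sym w~v , Adj-sym u~w)

  Far-sym : ∀ {u v} → Far u v → Far v u
  Far-sym (u≢v , u≁v) = ≢-sym u≢v , λ near → u≁v (Near-sym near)

  ¬Far⇒Near : ∀ {u v} → u ≢ v → ¬ Far u v → Near u v
  ¬Far⇒Near {u} {v} u≢v ¬far = decidable-stable (Near? u v) λ u≁v → ¬far (u≢v , u≁v)

  cover-from-outside : ∀ {L : List V} → (∀ {z} → All (z ≢_) L → ⊥) → ∀ z → z ∈ L
  cover-from-outside {L} outside z = decidable-stable (z ∈? L) λ z∉L → outside (¬Any⇒All¬ L z∉L)

  TwoNeighbours : V → Set
  TwoNeighbours u = Σ V λ a → Σ V λ b → Adj G u a × Adj G u b × a ≢ b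

  TwoMoreNeighbours : V → V → Set
  TwoMoreNeighbours u v = Σ V λ a → Σ V λ b → Adj G u a × Adj G u b × a ≢ b × a ≢ v × b ≢ v

  ThreeFar : V → Set
  ThreeFar u = Σ V λ a → Σ V λ b → Σ V λ c →
    Far u a × Far u b × Far u c × a ≢ b × a ≢ c × b ≢ c

  record Hexagon : Set where
    field
      c0 c1 c2 c3 c4 c5 : V
      c0~c1 : Adj G c0 c1
      c1~c2 : Adj G c1 c2
      c2~c3 : Adj G c2 c3
      c3~c4 : Adj G c3 c4
      c4~c5 : Adj G c4 c5
      c5~c0 : Adj G c5 c0
      -- adjacent corners are distinct by Adj⇒≢, so only the other pairs are recorded
      c0≢c2 : c0 ≢ c2
      c1≢c3 : c1 ≢ c3
      c2≢c4 : c2 ≢ c4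
      c3≢c5 : c3 ≢ c5
      c4≢c0 : c4 ≢ c0
      c5≢c1 : c5 ≢ c1
      c0≢c3 : c0 ≢ c3
      c1≢c4 : c1 ≢ c4
      c2≢c5 : c2 ≢ c5

  hexagon-from-cycle : HasCycleOfLength G 6 → Hexagon
  hexagon-from-cycle (_ , v , v-injective , path , closing) = record
    { c0 = v (# 0) ; c1 = v (# 1) ; c2 = v (# 2) ; c3 = v (# 3) ; c4 = v (# 4) ; c5 = v (# 5)
    ; c0~c1 = path (# 0) ; c1~c2 = path (# 1) ; c2~c3 = path (# 2) ; c3~c4 = path (# 3) ; c4~c5 = path (# 4)
    ; c5~c0 = closing
    ; c0≢c2 = distinct (# 0) (# 2) (λ ()) ; c1≢c3 = distinct (# 1) (# 3) (λ ()) ; c2≢c4 = distinct (# 2) (# 4) (λ ())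
    ; c3≢c5 = distinct (# 3) (# 5) (λ ()) ; c4≢c0 = distinct (# 4) (# 0) (λ ()) ; c5≢c1 = distinct (# 5) (# 1) (λ ())
    ; c0≢c3 = distinct (# 0) (# 3) (λ ()) ; c1≢c4 = distinct (# 1) (# 4) (λ ()) ; c2≢c5 = distinct (# 2) (# 5) (λ ())
    }
    where
      distinct : ∀ i j → i ≢ j → v i ≢ v j
      distinct i j i≢j vi≡vj = i≢j (v-injective vi≡vj)

  rot : Hexagon → Hexagon
  rot h = record
    { c0 = c1 ; c1 = c2 ; c2 = c3 ; c3 = c4 ; c4 = c5 ; c5 = c0
    ; c0~c1 = c1~c2 ; c1~c2 = c2~c3 ; c2~c3 = c3~c4 ; c3~c4 = c4~c5 ; c4~c5 = c5~c0 ; c5~c0 = c0~c1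
    ; c0≢c2 = c1≢c3 ; c1≢c3 = c2≢c4 ; c2≢c4 = c3≢c5 ; c3≢c5 = c4≢c0 ; c4≢c0 = c5≢c1 ; c5≢c1 = c0≢c2
    ; c0≢c3 = c1≢c4 ; c1≢c4 = c2≢c5 ; c2≢c5 = ≢-sym c0≢c3
    }
    where open Hexagon h

  opposite : Hexagon → Hexagon
  opposite h = rot (rot (rot h))

  rot⁻¹ : Hexagon → Hexagon
  rot⁻¹ h = rot (rot (opposite h))

  vertices : Hexagon → List V
  vertices h = c0 ∷ c1 ∷ c2 ∷ c3 ∷ c4 ∷ c5 ∷ []
    where open Hexagon h

  vertices-↭-rot : ∀ h → vertices h ↭ vertices (rot h)
  vertices-↭-rot h = ↭-sym (shift c0 (c1 ∷ c2 ∷ c3 ∷ c4 ∷ c5 ∷ []) [])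
    where open Hexagon h

  vertices-TwoNeighbours : ∀ h → All TwoNeighbours (vertices h)
  vertices-TwoNeighbours h =
    (c1 , c5 , c0~c1 , Adj-sym c5~c0 , ≢-sym c5≢c1) ∷
    (c0 , c2 , Adj-sym c0~c1 , c1~c2 , c0≢c2) ∷
    (c1 , c3 , Adj-sym c1~c2 , c2~c3 , c1≢c3) ∷
    (c2 , c4 , Adj-sym c2~c3 , c3~c4 , c2≢c4) ∷
    (c3 , c5 , Adj-sym c3~c4 , c4~c5 , c3≢c5) ∷
    (c4 , c0 , Adj-sym c4~c5 , c5~c0 , c4≢c0) ∷ []
    where open Hexagon h

  module ShortCycleFree (girth≥6 : ∀ l → HasCycleOfLength G l → 6 ≤ l) where

    no-short-cycle : ∀ {k} → k < 3 → (vs : Vec V (3 + k)) → Unique vs →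
                     (∀ i → Adj G (lookup vs (inject₁ i)) (lookup vs (suc i))) →
                     Adj G (lookup vs (fromℕ (2 + k))) (lookup vs zero) → ⊥
    no-short-cycle {k} k<3 vs distinct path closing =
      <⇒≱ (+-monoʳ-< 3 k<3)
        (girth≥6 (3 + k) (m≤m+n 3 k , lookup vs , (λ {i} {j} → lookup-injective distinct i j) , path , closing))

    no-triangle : ∀ {a b c} → Adj G a b → Adj G b c → Adj G c a → ⊥
    no-triangle {a} {b} {c} a~b b~c c~a = no-short-cycle z<s (a ∷ b ∷ c ∷ [])
      ((Adj⇒≢ a~b ∷ ≢-sym (Adj⇒≢ c~a) ∷ []) ∷ (Adj⇒≢ b~c ∷ []) ∷ [] ∷ [])
      (λ { zero → a~b ; (suc zero) → b~c })
      c~a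

    no-square : ∀ {a b c d} → Adj G a b → Adj G b c → Adj G c d → Adj G d a → a ≢ c → b ≢ d → ⊥
    no-square {a} {b} {c} {d} a~b b~c c~d d~a a≢c b≢d = no-short-cycle (s<s z<s) (a ∷ b ∷ c ∷ d ∷ [])
      ((Adj⇒≢ a~b ∷ a≢c ∷ ≢-sym (Adj⇒≢ d~a) ∷ []) ∷ (Adj⇒≢ b~c ∷ b≢d ∷ []) ∷ (Adj⇒≢ c~d ∷ []) ∷ [] ∷ [])
      (λ { zero → a~b ; (suc zero) → b~c ; (suc (suc zero)) → c~d })
      d~a

    no-closed-5-walk : ∀ {a b c d e} → Adj G a b → Adj G b c → Adj G c d → Adj G d e → Adj G e a → ⊥
    no-closed-5-walk {a} {b} {c} {d} {e} a~b b~c c~d d~e e~a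
      with a ≟ c | a ≟ d | b ≟ d | b ≟ e | c ≟ e
    ... | yes refl | _        | _        | _        | _        = no-triangle c~d d~e e~a
    ... | no _     | yes refl | _        | _        | _        = no-triangle a~b b~c c~d
    ... | no _     | no _     | yes refl | _        | _        = no-triangle a~b d~e e~a
    ... | no _     | no _     | no _     | yes refl | _        = no-triangle b~c c~d d~e
    ... | no _     | no _     | no _     | no _     | yes refl = no-triangle a~b b~c e~a
    ... | no a≢c   | no a≢d   | no b≢d   | no b≢e   | no c≢e   =
      no-short-cycle (s<s (s<s z<s)) (a ∷ b ∷ c ∷ d ∷ e ∷ [])
        ((Adj⇒≢ a~b ∷ a≢c ∷ a≢d ∷ ≢-sym (Adj⇒≢ e~a) ∷ []) ∷ (Adj⇒≢ b~c ∷ b≢d ∷ b≢e ∷ []) ∷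
         (Adj⇒≢ c~d ∷ c≢e ∷ []) ∷ (Adj⇒≢ d~e ∷ []) ∷ [] ∷ [])
        (λ { zero → a~b ; (suc zero) → b~c ; (suc (suc zero)) → c~d ; (suc (suc (suc zero))) → d~e })
        e~a

    path₃-far : ∀ {a b c d} → Adj G a b → Adj G b c → Adj G c d → a ≢ c → b ≢ d → a ≢ d → Far a d
    path₃-far a~b b~c c~d a≢c b≢d a≢d = a≢d , λ
      { (inj₁ a~d)             → no-square a~b b~c c~d (Adj-sym a~d) a≢c b≢d
      ; (inj₂ (w , a~w , w~d)) → no-closed-5-walk a~b b~c c~d (Adj-sym w~d) (Adj-sym a~w)
      }

    module _ (h : Hexagon) where
      open Hexagon h

      c0-far-c3 : Far c0 c3
      c0-far-c3 = path₃-far c0~c1 c1~c2 c2~c3 c0≢c2 c1≢c3 c0≢c3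

      c0-neighbour≢c3 : ∀ {z} → Adj G c0 z → z ≢ c3
      c0-neighbour≢c3 c0~z z≡c3 = proj₂ c0-far-c3 (inj₁ (subst (Adj G c0) z≡c3 c0~z))

      c0-far-only-c3 : All (λ w → Far c0 w → w ≡ c3) (vertices h)
      c0-far-only-c3 =
        (λ far → contradiction refl (proj₁ far)) ∷
        (λ far → contradiction (inj₁ c0~c1) (proj₂ far)) ∷
        (λ far → contradiction (inj₂ (c1 , c0~c1 , c1~c2)) (proj₂ far)) ∷
        (λ _ → refl) ∷
        (λ far → contradiction (inj₂ (c5 , Adj-sym c5~c0 , Adj-sym c4~c5)) (proj₂ far)) ∷
        (λ far → contradiction (inj₁ (Adj-sym c5~c0)) (proj₂ far)) ∷ []

      neighbour-of-c0-far : ∀ {z} → Adj G c0 z → z ≢ c1 → z ≢ c5 → Far z c2 × Far z c4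
      neighbour-of-c0-far {z} c0~z z≢c1 z≢c5 =
        path₃-far (Adj-sym c0~z) c0~c1 c1~c2 z≢c1 c0≢c2 z≢c2 ,
        path₃-far (Adj-sym c0~z) (Adj-sym c5~c0) (Adj-sym c4~c5) z≢c5 (≢-sym c4≢c0) z≢c4
        where
          z≢c2 : z ≢ c2
          z≢c2 z≡c2 = no-triangle (subst (Adj G c0) z≡c2 c0~z) (Adj-sym c1~c2) (Adj-sym c0~c1)

          z≢c4 : z ≢ c4
          z≢c4 z≡c4 = no-triangle (subst (Adj G c0) z≡c4 c0~z) c4~c5 c5~c0

      near-c2-c3-c4⇒adj-c3 : ∀ {z} → z ≢ c3 → Near z c2 → Near z c3 → Near z c4 → Adj G z c3
      near-c2-c3-c4⇒adj-c3 _ _ (inj₁ z~c3) _ = z~c3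
      near-c2-c3-c4⇒adj-c3 _ (inj₂ (u , z~u , u~c2)) (inj₂ (w , z~w , w~c3)) _ =
        ⊥-elim (no-closed-5-walk z~u u~c2 c2~c3 (Adj-sym w~c3) (Adj-sym z~w))
      near-c2-c3-c4⇒adj-c3 z≢c3 (inj₁ z~c2) (inj₂ _) (inj₁ z~c4) =
        ⊥-elim (no-square z~c2 c2~c3 c3~c4 (Adj-sym z~c4) z≢c3 c2≢c4)
      near-c2-c3-c4⇒adj-c3 _ (inj₁ z~c2) (inj₂ _) (inj₂ (w , z~w , w~c4)) =
        ⊥-elim (no-closed-5-walk z~c2 c2~c3 c3~c4 (Adj-sym w~c4) (Adj-sym z~w))

  module SquareComplementary (squco : Squco G) where

    σ : V → V
    σ = Inverse.to (proj₁ squco)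

    σ⁻¹ : V → V
    σ⁻¹ = Inverse.from (proj₁ squco)

    σ-injective : ∀ {a b} → σ a ≡ σ b → a ≡ b
    σ-injective = Injection.injective (↔⇒↣ (proj₁ squco))

    σ⁻¹-injective : ∀ {a b} → σ⁻¹ a ≡ σ⁻¹ b → a ≡ b
    σ⁻¹-injective = Injection.injective (↔⇒↣ (↔-sym (proj₁ squco)))

    σ-≢ : ∀ {a b} → a ≢ b → σ a ≢ σ b
    σ-≢ a≢b σa≡σb = a≢b (σ-injective σa≡σb)

    Far⇒Adj-σ : ∀ {a b} → Far a b → Adj G (σ a) (σ b)
    Far⇒Adj-σ {a} {b} (a≢b , a≁b) = decidable-stable (Adj? (σ a) (σ b)) λ ¬σa~σb →
      a≁b (proj₂ (Equivalence.from (proj₂ squco a b) (σ-≢ a≢b , ¬σa~σb)))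

    Adj-σ⇒Far : ∀ {a b} → Adj G (σ a) (σ b) → Far a b
    Adj-σ⇒Far {a} {b} σa~σb = a≢b , λ near → proj₂ (Equivalence.to (proj₂ squco a b) (a≢b , near)) σa~σb
      where
        a≢b : a ≢ b
        a≢b a≡b = Adj⇒≢ σa~σb (cong σ a≡b)

    Adj-σ⇒Far-σ⁻¹ : ∀ {v t} → Adj G (σ v) t → Far v (σ⁻¹ t)
    Adj-σ⇒Far-σ⁻¹ {v} {t} σv~t =
      Adj-σ⇒Far (subst (Adj G (σ v)) (≡-sym (Inverse.strictlyInverseˡ (proj₁ squco) t)) σv~t)

    sole-far⇒¬TwoNeighbours-σ : ∀ {v p} → (∀ w → Far v w → w ≡ p) → ¬ TwoNeighbours (σ v)
    sole-far⇒¬TwoNeighbours-σ lonely (a , b , σv~a , σv~b , a≢b) =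
      a≢b (σ⁻¹-injective (trans (lonely _ (Adj-σ⇒Far-σ⁻¹ σv~a)) (≡-sym (lonely _ (Adj-σ⇒Far-σ⁻¹ σv~b)))))

    σ-lonely∉ : ∀ {v p L} → (∀ w → Far v w → w ≡ p) → All TwoNeighbours L → σ v ∉ L
    σ-lonely∉ lonely twos σv∈L = sole-far⇒¬TwoNeighbours-σ lonely (All.lookup twos σv∈L)

  module SquareComplementaryGirth6 (squco : Squco G) (girth≥6 : ∀ l → HasCycleOfLength G l → 6 ≤ l) where
    open SquareComplementary squco
    open ShortCycleFree girth≥6

    no-far-triangle : ∀ {a b c} → Far a b → Far b c → Far a c → ⊥
    no-far-triangle a-b b-c a-c = no-triangle (Far⇒Adj-σ a-b) (Far⇒Adj-σ b-c) (Far⇒Adj-σ (Far-sym a-c))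

    adjacent-not-both-branching : ∀ {u v} → Adj G u v → TwoMoreNeighbours u v → TwoMoreNeighbours v u → ⊥
    adjacent-not-both-branching {u} {v} u~v
      (a , a′ , u~a , u~a′ , a≢a′ , a≢v , a′≢v) (b , b′ , v~b , v~b′ , b≢b′ , b≢u , b′≢u) =
      no-square (Far⇒Adj-σ (far u~a v~b a≢v b≢u)) (Far⇒Adj-σ (Far-sym (far u~a′ v~b a′≢v b≢u)))
                (Far⇒Adj-σ (far u~a′ v~b′ a′≢v b′≢u)) (Far⇒Adj-σ (Far-sym (far u~a v~b′ a≢v b′≢u)))
                (σ-≢ a≢a′) (σ-≢ b≢b′)
      where
        far : ∀ {x y} → Adj G u x → Adj G v y → x ≢ v → y ≢ u → Far x y
        far {x} {y} u~x v~y x≢v y≢u = path₃-far (Adj-sym u~x) u~v v~y x≢v (≢-sym y≢u) x≢y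
          where
            x≢y : x ≢ y
            x≢y x≡y = no-triangle u~v (subst (Adj G v) (≡-sym x≡y) v~y) (Adj-sym u~x)

    ThreeFar⇒TwoMoreNeighbours-σ : ∀ {p} → ThreeFar p → ∀ q → TwoMoreNeighbours (σ p) (σ q)
    ThreeFar⇒TwoMoreNeighbours-σ (a , b , c , p-a , p-b , p-c , a≢b , a≢c , b≢c) q with a ≟ q | b ≟ q
    ... | yes refl | _        = σ b , σ c , Far⇒Adj-σ p-b , Far⇒Adj-σ p-c , σ-≢ b≢c , σ-≢ (≢-sym a≢b) , σ-≢ (≢-sym a≢c)
    ... | no a≢q   | yes refl = σ a , σ c , Far⇒Adj-σ p-a , Far⇒Adj-σ p-c , σ-≢ a≢c , σ-≢ a≢q , σ-≢ (≢-sym b≢c)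
    ... | no a≢q   | no b≢q   = σ a , σ b , Far⇒Adj-σ p-a , Far⇒Adj-σ p-b , σ-≢ a≢b , σ-≢ a≢q , σ-≢ b≢q

    far-not-both-ThreeFar : ∀ {p q} → Far p q → ThreeFar p → ThreeFar q → ⊥
    far-not-both-ThreeFar {p} {q} p-q p-three q-three =
      adjacent-not-both-branching (Far⇒Adj-σ p-q)
        (ThreeFar⇒TwoMoreNeighbours-σ p-three q) (ThreeFar⇒TwoMoreNeighbours-σ q-three p)

    module PendantCase (h : Hexagon) {x : V} (c0~x : Adj G (Hexagon.c0 h) x)
                       (x≢c1 : x ≢ Hexagon.c1 h) (x≢c5 : x ≢ Hexagon.c5 h) (x≁c3 : ¬ Near x (Hexagon.c3 h)) where
      open Hexagon h

      x-far-c2 : Far x c2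
      x-far-c2 = proj₁ (neighbour-of-c0-far h c0~x x≢c1 x≢c5)

      x-far-c4 : Far x c4
      x-far-c4 = proj₂ (neighbour-of-c0-far h c0~x x≢c1 x≢c5)

      x-far-c3 : Far x c3
      x-far-c3 = c0-neighbour≢c3 h c0~x , x≁c3

      x-ThreeFar : ThreeFar x
      x-ThreeFar = c2 , c3 , c4 , x-far-c2 , x-far-c3 , x-far-c4 , Adj⇒≢ c2~c3 , c2≢c4 , Adj⇒≢ c3~c4

      far-c2-only-c5-or-x : ∀ {z} → Far z c2 → z ≢ c5 → z ≢ x → ⊥
      far-c2-only-c5-or-x {z} z-c2 z≢c5 z≢x = far-not-both-ThreeFar x-far-c2 x-ThreeFar
        (c5 , x , z , c0-far-c3 (rot (rot h)) , Far-sym x-far-c2 , Far-sym z-c2 , ≢-sym x≢c5 , ≢-sym z≢c5 , ≢-sym z≢x)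

      far-c3-only-c0-or-x : ∀ {z} → Far z c3 → z ≢ c0 → z ≢ x → ⊥
      far-c3-only-c0-or-x {z} z-c3 z≢c0 z≢x = far-not-both-ThreeFar x-far-c3 x-ThreeFar
        (c0 , x , z , Far-sym (c0-far-c3 h) , Far-sym x-far-c3 , Far-sym z-c3 , Adj⇒≢ c0~x , ≢-sym z≢c0 , ≢-sym z≢x)

      far-c4-only-c1-or-x : ∀ {z} → Far z c4 → z ≢ c1 → z ≢ x → ⊥
      far-c4-only-c1-or-x {z} z-c4 z≢c1 z≢x = far-not-both-ThreeFar x-far-c4 x-ThreeFar
        (c1 , x , z , Far-sym (c0-far-c3 (rot h)) , Far-sym x-far-c4 , Far-sym z-c4 , ≢-sym x≢c1 , ≢-sym z≢c1 , ≢-sym z≢x)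

      outside⇒adj-c3 : ∀ {z} → All (z ≢_) (x ∷ vertices h) → Adj G z c3
      outside⇒adj-c3 (z≢x ∷ z≢c0 ∷ z≢c1 ∷ z≢c2 ∷ z≢c3 ∷ z≢c4 ∷ z≢c5 ∷ []) = near-c2-c3-c4⇒adj-c3 h z≢c3
        (¬Far⇒Near z≢c2 λ z-c2 → far-c2-only-c5-or-x z-c2 z≢c5 z≢x)
        (¬Far⇒Near z≢c3 λ z-c3 → far-c3-only-c0-or-x z-c3 z≢c0 z≢x)
        (¬Far⇒Near z≢c4 λ z-c4 → far-c4-only-c1-or-x z-c4 z≢c1 z≢x)

      x-leaf : ∀ {t} → Adj G x t → t ≡ c0
      x-leaf {t} x~t = decidable-stable (t ≟ c0) λ t≢c0 →
        x≁c3 (inj₂ (t , x~t , outside⇒adj-c3 (≢-sym (Adj⇒≢ x~t) ∷ t≢c0 ∷ t≢c1 ∷ t≢far-of-x x-far-c2 ∷ t≢c3 ∷ t≢far-of-x x-far-c4 ∷ t≢c5 ∷ [])))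
        where
          t≢far-of-x : ∀ {c} → Far x c → t ≢ c
          t≢far-of-x x-c t≡c = proj₂ x-c (inj₁ (subst (Adj G x) t≡c x~t))

          t≢c1 : t ≢ c1
          t≢c1 t≡c1 = no-triangle (subst (Adj G x) t≡c1 x~t) (Adj-sym c0~c1) c0~x

          t≢c3 : t ≢ c3
          t≢c3 t≡c3 = x≁c3 (inj₁ (subst (Adj G x) t≡c3 x~t))

          t≢c5 : t ≢ c5
          t≢c5 t≡c5 = no-triangle (subst (Adj G x) t≡c5 x~t) c5~c0 c0~x

      outside : ∀ {z} → All (z ≢_) (x ∷ vertices h) → ⊥
      outside {z} z∉@(z≢x ∷ z≢c0 ∷ z≢c1 ∷ z≢c2 ∷ _ ∷ z≢c4 ∷ z≢c5 ∷ []) = far-not-both-ThreeFar z-far-x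
        (c1 , c5 , x , z-far-c1 , z-far-c5 , z-far-x , ≢-sym c5≢c1 , ≢-sym x≢c1 , ≢-sym x≢c5) x-ThreeFar
        where
          z~c3 : Adj G z c3
          z~c3 = outside⇒adj-c3 z∉

          z-far-c1 : Far z c1
          z-far-c1 = path₃-far z~c3 (Adj-sym c2~c3) (Adj-sym c1~c2) z≢c2 (≢-sym c1≢c3) z≢c1

          z-far-c5 : Far z c5
          z-far-c5 = path₃-far z~c3 c3~c4 c4~c5 z≢c4 c3≢c5 z≢c5

          z-far-x : Far z x
          z-far-x = z≢x , λ
            { (inj₁ z~x)             → z≢c0 (x-leaf (Adj-sym z~x))
            ; (inj₂ (w , z~w , w~x)) → no-closed-5-walk (subst (Adj G z) (x-leaf (Adj-sym w~x)) z~w)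
                                         c0~c1 c1~c2 c2~c3 (Adj-sym z~c3)
            }

      impossible : ⊥
      impossible = Adj⇒≢ c0~c1 (σ-injective (trans (σ-lonely⇒≡x c0-lonely) (≡-sym (σ-lonely⇒≡x c1-lonely))))
        where
          covered : ∀ z → z ∈ x ∷ vertices h
          covered = cover-from-outside outside

          σ-lonely⇒≡x : ∀ {v p} → (∀ w → Far v w → w ≡ p) → σ v ≡ x
          σ-lonely⇒≡x {v} lonely =
            [ id , (λ σv∈ → ⊥-elim (σ-lonely∉ lonely (vertices-TwoNeighbours h) σv∈)) ] (toSum (covered (σ v)))

          c0-lonely : ∀ w → Far c0 w → w ≡ c3
          c0-lonely w = All.lookup ((λ c0-x → contradiction (inj₁ c0~x) (proj₂ c0-x)) ∷ c0-far-only-c3 h) (covered w)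

          c1-lonely : ∀ w → Far c1 w → w ≡ c4
          c1-lonely w = All.lookup ((λ c1-x → contradiction (inj₂ (c0 , Adj-sym c0~c1 , c0~x)) (proj₂ c1-x)) ∷ c0-far-only-c3 (rot h))
                                   (∈-resp-↭ (prep x (vertices-↭-rot h)) (covered w))

    module ThetaNeighbourhoods (h : Hexagon) {x y : V} (c0~x : Adj G (Hexagon.c0 h) x)
                               (x≢c1 : x ≢ Hexagon.c1 h) (x≢c5 : x ≢ Hexagon.c5 h)
                               (x~y : Adj G x y) (y~c3 : Adj G y (Hexagon.c3 h)) where
      open Hexagon h

      x-far-c2 : Far x c2
      x-far-c2 = proj₁ (neighbour-of-c0-far h c0~x x≢c1 x≢c5)

      x-far-c4 : Far x c4
      x-far-c4 = proj₂ (neighbour-of-c0-far h c0~x x≢c1 x≢c5)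

      y≢c0 : y ≢ c0
      y≢c0 = c0-neighbour≢c3 (opposite h) (Adj-sym y~c3)

      y≢c1 : y ≢ c1
      y≢c1 y≡c1 = no-triangle (subst (Adj G x) y≡c1 x~y) (Adj-sym c0~c1) c0~x

      y≢c2 : y ≢ c2
      y≢c2 y≡c2 = proj₂ x-far-c2 (inj₁ (subst (Adj G x) y≡c2 x~y))

      y≢c4 : y ≢ c4
      y≢c4 y≡c4 = proj₂ x-far-c4 (inj₁ (subst (Adj G x) y≡c4 x~y))

      c0-neighbours : ∀ {z} → Adj G c0 z → z ≢ c1 → z ≢ c5 → z ≢ x → ⊥
      c0-neighbours {z} c0~z z≢c1 z≢c5 z≢x with Near? z c3
      ... | no z≁c3 = PendantCase.far-c2-only-c5-or-x h c0~z z≢c1 z≢c5 z≁c3 x-far-c2 x≢c5 (≢-sym z≢x)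
      ... | yes (inj₁ z~c3) = no-closed-5-walk c0~z z~c3 (Adj-sym c2~c3) (Adj-sym c1~c2) (Adj-sym c0~c1)
      ... | yes (inj₂ (w , z~w , w~c3)) = far-not-both-ThreeFar c1-far-c4
          (c4 , y , w , c1-far-c4 , c1-far y~c3 y≢c1 y≢c2 , c1-far w~c3 w≢c1 w≢c2 , ≢-sym y≢c4 , ≢-sym w≢c4 , ≢-sym w≢y)
          (c1 , x , z , Far-sym c1-far-c4 , Far-sym x-far-c4 , Far-sym z-far-c4 , ≢-sym x≢c1 , ≢-sym z≢c1 , ≢-sym z≢x)
        where
          z-far-c2 : Far z c2
          z-far-c2 = proj₁ (neighbour-of-c0-far h c0~z z≢c1 z≢c5)

          z-far-c4 : Far z c4
          z-far-c4 = proj₂ (neighbour-of-c0-far h c0~z z≢c1 z≢c5)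

          c1-far-c4 : Far c1 c4
          c1-far-c4 = c0-far-c3 (rot h)

          c1-far : ∀ {u} → Adj G u c3 → u ≢ c1 → u ≢ c2 → Far c1 u
          c1-far u~c3 u≢c1 u≢c2 = path₃-far c1~c2 c2~c3 (Adj-sym u~c3) c1≢c3 (≢-sym u≢c2) (≢-sym u≢c1)

          w≢far-of-z : ∀ {c} → Far z c → w ≢ c
          w≢far-of-z z-c w≡c = proj₂ z-c (inj₁ (subst (Adj G z) w≡c z~w))

          w≢c1 : w ≢ c1
          w≢c1 w≡c1 = no-triangle (subst (Adj G z) w≡c1 z~w) (Adj-sym c0~c1) c0~z

          w≢c2 : w ≢ c2
          w≢c2 = w≢far-of-z z-far-c2

          w≢c4 : w ≢ c4
          w≢c4 = w≢far-of-z z-far-c4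

          w≢y : w ≢ y
          w≢y w≡y = no-square (subst (Adj G z) w≡y z~w) (Adj-sym x~y) (Adj-sym c0~x) c0~z z≢x y≢c0

      c1-neighbours : ∀ {t} → Adj G c1 t → t ≢ c0 → t ≢ c2 → ⊥
      c1-neighbours c1~t t≢c0 t≢c2 = adjacent-not-both-branching c0~c1
        (c5 , x , Adj-sym c5~c0 , c0~x , ≢-sym x≢c5 , c5≢c1 , x≢c1)
        (c2 , _ , c1~c2 , c1~t , ≢-sym t≢c2 , ≢-sym c0≢c2 , t≢c0)

      c5-neighbours : ∀ {t} → Adj G c5 t → t ≢ c0 → t ≢ c4 → ⊥
      c5-neighbours c5~t t≢c0 t≢c4 = adjacent-not-both-branching (Adj-sym c5~c0)
        (c1 , x , c0~c1 , c0~x , ≢-sym x≢c1 , ≢-sym c5≢c1 , x≢c5)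
        (c4 , _ , Adj-sym c4~c5 , c5~t , ≢-sym t≢c4 , c4≢c0 , t≢c0)

      x-neighbours : ∀ {t} → Adj G x t → t ≢ c0 → t ≢ y → ⊥
      x-neighbours x~t t≢c0 t≢y = adjacent-not-both-branching c0~x
        (c1 , c5 , c0~c1 , Adj-sym c5~c0 , ≢-sym c5≢c1 , ≢-sym x≢c1 , ≢-sym x≢c5)
        (y , _ , x~y , x~t , ≢-sym t≢y , y≢c0 , t≢c0)

      not-near-c0 : ∀ {z} → z ≢ c0 → z ≢ c1 → z ≢ c2 → z ≢ c4 → z ≢ c5 → z ≢ x → z ≢ y → ¬ Near z c0
      not-near-c0 _ z≢c1 _ _ z≢c5 z≢x _ (inj₁ z~c0) = c0-neighbours (Adj-sym z~c0) z≢c1 z≢c5 z≢x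
      not-near-c0 z≢c0 _ z≢c2 z≢c4 _ _ z≢y (inj₂ (w , z~w , w~c0)) with w ≟ c1 | w ≟ c5 | w ≟ x
      ... | yes refl | _        | _        = c1-neighbours (Adj-sym z~w) z≢c0 z≢c2
      ... | no _     | yes refl | _        = c5-neighbours (Adj-sym z~w) z≢c0 z≢c4
      ... | no _     | no _     | yes refl = x-neighbours (Adj-sym z~w) z≢c0 z≢y
      ... | no w≢c1  | no w≢c5  | no w≢x   = c0-neighbours (Adj-sym w~c0) w≢c1 w≢c5 w≢x

    module ThetaCase (h : Hexagon) {x y : V} (c0~x : Adj G (Hexagon.c0 h) x)
                     (x≢c1 : x ≢ Hexagon.c1 h) (x≢c5 : x ≢ Hexagon.c5 h)
                     (x~y : Adj G x y) (y~c3 : Adj G y (Hexagon.c3 h)) where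
      open Hexagon h
      open ThetaNeighbourhoods h c0~x x≢c1 x≢c5 x~y y~c3
      module Opposite = ThetaNeighbourhoods (opposite h) (Adj-sym y~c3) y≢c4 y≢c2 (Adj-sym x~y) (Adj-sym c0~x)

      outside : ∀ {z} → All (z ≢_) (x ∷ y ∷ vertices h) → ⊥
      outside (z≢x ∷ z≢y ∷ z≢c0 ∷ z≢c1 ∷ z≢c2 ∷ z≢c3 ∷ z≢c4 ∷ z≢c5 ∷ []) = no-far-triangle (c0-far-c3 h)
        (Far-sym (z≢c3 , Opposite.not-near-c0 z≢c3 z≢c4 z≢c5 z≢c1 z≢c2 z≢y z≢x))
        (Far-sym (z≢c0 , not-near-c0 z≢c0 z≢c1 z≢c2 z≢c4 z≢c5 z≢x z≢y))

      impossible : ⊥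
      impossible = σ-lonely∉ c0-lonely twos (covered (σ c0))
        where
          covered : ∀ z → z ∈ x ∷ y ∷ vertices h
          covered = cover-from-outside outside

          twos : All TwoNeighbours (x ∷ y ∷ vertices h)
          twos = (c0 , y , Adj-sym c0~x , x~y , ≢-sym y≢c0) ∷
                 (x , c3 , Adj-sym x~y , y~c3 , c0-neighbour≢c3 h c0~x) ∷ vertices-TwoNeighbours h

          c0-lonely : ∀ w → Far c0 w → w ≡ c3
          c0-lonely w = All.lookup
            ((λ c0-x → contradiction (inj₁ c0~x) (proj₂ c0-x)) ∷
             (λ c0-y → contradiction (inj₂ (x , c0~x , x~y)) (proj₂ c0-y)) ∷ c0-far-only-c3 h)
            (covered w)

    no-extra-neighbour : ∀ h {x} → Adj G (Hexagon.c0 h) x → x ≢ Hexagon.c1 h → x ≢ Hexagon.c5 h → ⊥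
    no-extra-neighbour h {x} c0~x x≢c1 x≢c5 with Near? x (Hexagon.c3 h)
    ... | no x≁c3 = PendantCase.impossible h c0~x x≢c1 x≢c5 x≁c3
    ... | yes (inj₁ x~c3) = no-closed-5-walk c0~x x~c3 (Adj-sym c2~c3) (Adj-sym c1~c2) (Adj-sym c0~c1)
      where open Hexagon h
    ... | yes (inj₂ (y , x~y , y~c3)) = ThetaCase.impossible h c0~x x≢c1 x≢c5 x~y y~c3

    off-hexagon-not-near-c0 : ∀ h {z} → All (z ≢_) (vertices h) → ¬ Near z (Hexagon.c0 h)
    off-hexagon-not-near-c0 h (_ ∷ z≢c1 ∷ _ ∷ _ ∷ _ ∷ z≢c5 ∷ []) (inj₁ z~c0) =
      no-extra-neighbour h (Adj-sym z~c0) z≢c1 z≢c5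
    off-hexagon-not-near-c0 h (z≢c0 ∷ _ ∷ z≢c2 ∷ _ ∷ z≢c4 ∷ _ ∷ []) (inj₂ (w , z~w , w~c0))
      with w ≟ Hexagon.c1 h | w ≟ Hexagon.c5 h
    ... | yes refl | _        = no-extra-neighbour (rot h) (Adj-sym z~w) z≢c2 z≢c0
    ... | no _     | yes refl = no-extra-neighbour (rot⁻¹ h) (Adj-sym z~w) z≢c0 z≢c4
    ... | no w≢c1  | no w≢c5  = no-extra-neighbour h (Adj-sym w~c0) w≢c1 w≢c5

    no-hexagon : Hexagon → ⊥
    no-hexagon h = σ-lonely∉ (λ w → All.lookup (c0-far-only-c3 h) (covered w)) (vertices-TwoNeighbours h) (covered (σ c0))
      where
        open Hexagon h

        outside : ∀ {z} → All (z ≢_) (vertices h) → ⊥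
        outside z∉@(z≢c0 ∷ z≢c1 ∷ z≢c2 ∷ z≢c3 ∷ z≢c4 ∷ z≢c5 ∷ []) = no-far-triangle (c0-far-c3 h)
          (Far-sym (z≢c3 , off-hexagon-not-near-c0 (opposite h) (z≢c3 ∷ z≢c4 ∷ z≢c5 ∷ z≢c0 ∷ z≢c1 ∷ z≢c2 ∷ [])))
          (Far-sym (z≢c0 , off-hexagon-not-near-c0 h z∉))

        covered : ∀ z → z ∈ vertices h
        covered = cover-from-outside outside

theorem3p1 : ∀ (n : ℕ) (G : Graph n) → ¬ (Squco G × HasGirth G 6)
theorem3p1 n G (squco , cycle , girth≥6) = no-hexagon (hexagon-from-cycle cycle)
  where
    open GraphProperties G
    open SquareComplementaryGirth6 squco girth≥6
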